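{- Let $M$ be a perfect matching of $G_n$ with an odd number of red edges, and let $L:U\cup V\to\{0,1\}$ be a labeling with $|L^{ -1}(1)|\equiv n\pmod 2$. Then $|M\cap E_L|\ge 1$.
   Context: $G_n=(U,V,E)$ is the bipartite multigraph with $|U|=|V|=n$ in which for every $u\in U$, $v\in V$ there are two parallel edges between $u$ and $v$, one red and one blue; an edge is written $e=(u,v,c)$ with $u\in U$, $v\in V$ and color $c\in\{\text{red},\text{blue}\}$. For a labeling $L:U\cup V\to\{0,1\}$ define $E_L:=\{(u,v,c): L(u)=L(v),\ c=\text{blue}\}\cup\{(u,v,c): L(u)\neq L(v),\ c=\text{red}\}$. -}

module Defs where

open import Data.Nat using (ℕ; zero; suc; _+_)
open import Data.Fin using (Fin)
open import Data.Bool using (Bool; true; false; _∧_; not)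
open import Data.Product using (_×_; _,_)
open import Data.Sum using (_⊎_; inj₁; inj₂)

∑ : (n : ℕ) → (Fin n → ℕ) → ℕ
∑ zero    f = 0
∑ (suc n) f = f Fin.zero + ∑ n (λ i → f (Fin.suc i))

⟦_⟧ : Bool → ℕ
⟦ true ⟧  = 1
⟦ false ⟧ = 0

data Color : Set where
  red blue : Color

-- Vertices of G_n: U = Fin n (inj₁), V = Fin n (inj₂).
Vertex : ℕ → Set
Vertex n = Fin n ⊎ Fin n

-- Edges of G_n: (u , v , c) with u ∈ U, v ∈ V, c a color.
Edge : ℕ → Set
Edge n = Fin n × Fin n × Color

EdgeSet : ℕ → Set
EdgeSet n = Edge n → Bool

∣_∣ₑ : {n : ℕ} → EdgeSet n → ℕ
∣_∣ₑ {n} S = ∑ n (λ u → ∑ n (λ v → ⟦ S (u , v , red) ⟧ + ⟦ S (u , v , blue) ⟧))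

_∩ₑ_ : {n : ℕ} → EdgeSet n → EdgeSet n → EdgeSet n
(S ∩ₑ T) e = S e ∧ T e

isRed : {n : ℕ} → EdgeSet n
isRed (_ , _ , red)  = true
isRed (_ , _ , blue) = false

degU : {n : ℕ} → EdgeSet n → Fin n → ℕ
degU {n} S u = ∑ n (λ v → ⟦ S (u , v , red) ⟧ + ⟦ S (u , v , blue) ⟧)

degV : {n : ℕ} → EdgeSet n → Fin n → ℕ
degV {n} S v = ∑ n (λ u → ⟦ S (u , v , red) ⟧ + ⟦ S (u , v , blue) ⟧)

IsPerfectMatching : {n : ℕ} → EdgeSet n → Set
IsPerfectMatching {n} M = ((u : Fin n) → degU M u ≡ 1) × ((v : Fin n) → degV M v ≡ 1)
  where open import Relation.Binary.PropositionalEquality using (_≡_)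

-- Labelings L : U ∪ V → {0,1}; the label 1 is represented by true, 0 by false.
Labeling : ℕ → Set
Labeling n = Vertex n → Bool

ones : {n : ℕ} → Labeling n → ℕ
ones {n} L = ∑ n (λ u → ⟦ L (inj₁ u) ⟧) + ∑ n (λ v → ⟦ L (inj₂ v) ⟧)

sameBool : Bool → Bool → Bool
sameBool true  b = b
sameBool false b = not b

E[_] : {n : ℕ} → Labeling n → EdgeSet n
E[ L ] (u , v , blue) = sameBool (L (inj₁ u)) (L (inj₂ v))
E[ L ] (u , v , red)  = not (sameBool (L (inj₁ u)) (L (inj₂ v)))

-- An edge (u , v , c) lies in E_L exactly when L(u) + L(v) + [c = red] is even, so
-- L(u) + L(v) + [c = red] + [e ∈ E_L] is odd for every edge. Summing over the n edges of a
-- perfect matching M counts each vertex label once, giving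
-- |L⁻¹(1)| + |M ∩ red| + |M ∩ E_L| ≡ n (mod 2); with |L⁻¹(1)| ≡ n and |M ∩ red| odd,
-- |M ∩ E_L| is odd, hence nonzero.
module Submission where

open import Defs
open import Data.Nat using (ℕ; zero; suc; _+_; _*_; _≤_; _%_; z≤n; s≤s; parity)
open import Data.Nat.Properties using (+-commutativeSemigroup; *-identityˡ; *-comm; *-zeroʳ; *-distribˡ-+)
open import Algebra.Properties.CommutativeSemigroup +-commutativeSemigroup using (interchange)
open import Data.Parity.Base as ℙ using (0ℙ; 1ℙ)
open import Data.Parity.Properties using (+-homo-+)
open import Data.Fin using (Fin)
open import Data.Bool using (true; false; _∧_; not)
open import Data.Product using (_,_)
open import Data.Sum using (inj₁; inj₂)
open import Relation.Binary.PropositionalEquality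
  using (_≡_; refl; sym; trans; cong; cong₂; module ≡-Reasoning)

open ≡-Reasoning

parity-%2 : ∀ n → parity (n % 2) ≡ parity n
parity-%2 0             = refl
parity-%2 1             = refl
parity-%2 (suc (suc n)) = parity-%2 n

parity≡1ℙ⇒1≤n : ∀ {n} → parity n ≡ 1ℙ → 1 ≤ n
parity≡1ℙ⇒1≤n {suc n} _ = s≤s z≤n

p+1ℙ+q≡p⇒q≡1ℙ : ∀ p q → p ℙ.+ 1ℙ ℙ.+ q ≡ p → q ≡ 1ℙ
p+1ℙ+q≡p⇒q≡1ℙ 0ℙ 1ℙ _  = refl
p+1ℙ+q≡p⇒q≡1ℙ 1ℙ 1ℙ _  = refl
p+1ℙ+q≡p⇒q≡1ℙ 0ℙ 0ℙ ()
p+1ℙ+q≡p⇒q≡1ℙ 1ℙ 0ℙ ()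

∑-cong : ∀ n {f g : Fin n → ℕ} → (∀ i → f i ≡ g i) → ∑ n f ≡ ∑ n g
∑-cong zero    f≗g = refl
∑-cong (suc n) f≗g = cong₂ _+_ (f≗g Fin.zero) (∑-cong n (λ i → f≗g (Fin.suc i)))

∑-parity-cong : ∀ n {f g : Fin n → ℕ} →
  (∀ i → parity (f i) ≡ parity (g i)) → parity (∑ n f) ≡ parity (∑ n g)
∑-parity-cong zero    f≗g = refl
∑-parity-cong (suc n) {f} {g} f≗g = begin
  parity (f Fin.zero + ∑ n (λ i → f (Fin.suc i)))
    ≡⟨ +-homo-+ (f Fin.zero) _ ⟩
  parity (f Fin.zero) ℙ.+ parity (∑ n (λ i → f (Fin.suc i)))
    ≡⟨ cong₂ ℙ._+_ (f≗g Fin.zero) (∑-parity-cong n (λ i → f≗g (Fin.suc i))) ⟩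
  parity (g Fin.zero) ℙ.+ parity (∑ n (λ i → g (Fin.suc i)))
    ≡⟨ +-homo-+ (g Fin.zero) _ ⟨
  parity (g Fin.zero + ∑ n (λ i → g (Fin.suc i))) ∎

∑-const-0 : ∀ n → ∑ n (λ _ → 0) ≡ 0
∑-const-0 zero    = refl
∑-const-0 (suc n) = ∑-const-0 n

∑-const-1 : ∀ n → ∑ n (λ _ → 1) ≡ n
∑-const-1 zero    = refl
∑-const-1 (suc n) = cong suc (∑-const-1 n)

∑-distrib-+ : ∀ n (f g : Fin n → ℕ) → ∑ n (λ i → f i + g i) ≡ ∑ n f + ∑ n g
∑-distrib-+ zero    f g = refl
∑-distrib-+ (suc n) f g =
  trans (cong (f Fin.zero + g Fin.zero +_) (∑-distrib-+ n _ _))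
        (interchange (f Fin.zero) (g Fin.zero) _ _)

*-distribˡ-∑ : ∀ n a (f : Fin n → ℕ) → a * ∑ n f ≡ ∑ n (λ i → a * f i)
*-distribˡ-∑ zero    a f = *-zeroʳ a
*-distribˡ-∑ (suc n) a f =
  trans (*-distribˡ-+ a (f Fin.zero) _) (cong (a * f Fin.zero +_) (*-distribˡ-∑ n a _))

∑-comm : ∀ m n (f : Fin m → Fin n → ℕ) →
  ∑ m (λ i → ∑ n (λ j → f i j)) ≡ ∑ n (λ j → ∑ m (λ i → f i j))
∑-comm zero    n f = sym (∑-const-0 n)
∑-comm (suc m) n f =
  trans (cong (∑ n (f Fin.zero) +_) (∑-comm m n (λ i → f (Fin.suc i))))
        (sym (∑-distrib-+ n (f Fin.zero) _))

∑-weights-1 : ∀ n {d : Fin n → ℕ} → (∀ i → d i ≡ 1) → (f : Fin n → ℕ) →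
  ∑ n (λ i → d i * f i) ≡ ∑ n f
∑-weights-1 n d≡1 f = ∑-cong n (λ i → trans (cong (_* f i) (d≡1 i)) (*-identityˡ (f i)))

∑∑ : (n : ℕ) → (Fin n → Fin n → ℕ) → ℕ
∑∑ n f = ∑ n (λ u → ∑ n (λ v → f u v))

∑∑-distrib-+ : ∀ n (f g : Fin n → Fin n → ℕ) →
  ∑∑ n (λ u v → f u v + g u v) ≡ ∑∑ n f + ∑∑ n g
∑∑-distrib-+ n f g =
  trans (∑-cong n (λ u → ∑-distrib-+ n (f u) (g u)))
        (∑-distrib-+ n (λ u → ∑ n (f u)) (λ u → ∑ n (g u)))

-- ∣ S ∣ₑ, degU S u and degV S v are sums of this over v, over u, and over both.
multiplicity : {n : ℕ} → EdgeSet n → Fin n → Fin n → ℕ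
multiplicity S u v = ⟦ S (u , v , red) ⟧ + ⟦ S (u , v , blue) ⟧

∑∑-multiplicity-*ˡ : ∀ {n} (S : EdgeSet n) (f : Fin n → ℕ) →
  ∑∑ n (λ u v → multiplicity S u v * f u) ≡ ∑ n (λ u → degU S u * f u)
∑∑-multiplicity-*ˡ {n} S f = ∑-cong n λ u → begin
  ∑ n (λ v → multiplicity S u v * f u) ≡⟨ ∑-cong n (λ v → *-comm (multiplicity S u v) (f u)) ⟩
  ∑ n (λ v → f u * multiplicity S u v) ≡⟨ *-distribˡ-∑ n (f u) (multiplicity S u) ⟨
  f u * degU S u                        ≡⟨ *-comm (f u) (degU S u) ⟩
  degU S u * f u                        ∎

∑∑-multiplicity-*ʳ : ∀ {n} (S : EdgeSet n) (g : Fin n → ℕ) →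
  ∑∑ n (λ u v → multiplicity S u v * g v) ≡ ∑ n (λ v → degV S v * g v)
∑∑-multiplicity-*ʳ {n} S g =
  trans (∑-comm n n (λ u v → multiplicity S u v * g v))
        (∑∑-multiplicity-*ˡ (λ { (u , v , c) → S (v , u , c) }) g)

-- r, b: membership of the red and the blue u–v edge in M; x, y: the labels of u and v.
-- The four summands are this pair's share of ∑ L(u), ∑ L(v), |M ∩ red| and |M ∩ E_L|.
edge-parity : ∀ r b x y →
  parity ((⟦ r ⟧ + ⟦ b ⟧) * ⟦ x ⟧ + (⟦ r ⟧ + ⟦ b ⟧) * ⟦ y ⟧
          + (⟦ r ∧ true ⟧ + ⟦ b ∧ false ⟧)
          + (⟦ r ∧ not (sameBool x y) ⟧ + ⟦ b ∧ sameBool x y ⟧))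
  ≡ parity (⟦ r ⟧ + ⟦ b ⟧)
edge-parity false false _     _     = refl
edge-parity false true  false false = refl
edge-parity false true  false true  = refl
edge-parity false true  true  false = refl
edge-parity false true  true  true  = refl
edge-parity true  false false false = refl
edge-parity true  false false true  = refl
edge-parity true  false true  false = refl
edge-parity true  false true  true  = refl
edge-parity true  true  false false = refl
edge-parity true  true  false true  = refl
edge-parity true  true  true  false = refl
edge-parity true  true  true  true  = refl

perfectMatching-parity : ∀ {n} (M : EdgeSet n) (L : Labeling n) → IsPerfectMatching M →
  parity (ones L + ∣ M ∩ₑ isRed ∣ₑ + ∣ M ∩ₑ E[ L ] ∣ₑ) ≡ parity n
perfectMatching-parity {n} M L (degU≡1 , degV≡1) = begin
  parity (ones L + ∣ M ∩ₑ isRed ∣ₑ + ∣ M ∩ₑ E[ L ] ∣ₑ) ≡⟨ cong parity count ⟨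
  parity (∑∑ n term)                                   ≡⟨ ∑-parity-cong n (λ u → ∑-parity-cong n (λ v →
                                                            edge-parity (M (u , v , red)) (M (u , v , blue))
                                                                        (L (inj₁ u)) (L (inj₂ v)))) ⟩
  parity (∑ n (degU M))                                ≡⟨ cong parity (trans (∑-cong n degU≡1) (∑-const-1 n)) ⟩
  parity n                                             ∎
  where
  labelU labelV : Fin n → ℕ
  labelU u = ⟦ L (inj₁ u) ⟧
  labelV v = ⟦ L (inj₂ v) ⟧

  term : Fin n → Fin n → ℕ
  term u v = multiplicity M u v * labelU u + multiplicity M u v * labelV v
           + multiplicity (M ∩ₑ isRed) u v + multiplicity (M ∩ₑ E[ L ]) u v

  count : ∑∑ n term ≡ ones L + ∣ M ∩ₑ isRed ∣ₑ + ∣ M ∩ₑ E[ L ] ∣ₑ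
  count = begin
    ∑∑ n term
      ≡⟨ ∑∑-distrib-+ n _ _ ⟩
    ∑∑ n (λ u v → multiplicity M u v * labelU u + multiplicity M u v * labelV v
                  + multiplicity (M ∩ₑ isRed) u v) + ∣ M ∩ₑ E[ L ] ∣ₑ
      ≡⟨ cong (_+ ∣ M ∩ₑ E[ L ] ∣ₑ) (∑∑-distrib-+ n _ _) ⟩
    ∑∑ n (λ u v → multiplicity M u v * labelU u + multiplicity M u v * labelV v)
      + ∣ M ∩ₑ isRed ∣ₑ + ∣ M ∩ₑ E[ L ] ∣ₑ
      ≡⟨ cong (λ k → k + ∣ M ∩ₑ isRed ∣ₑ + ∣ M ∩ₑ E[ L ] ∣ₑ) (∑∑-distrib-+ n _ _) ⟩
    ∑∑ n (λ u v → multiplicity M u v * labelU u) + ∑∑ n (λ u v → multiplicity M u v * labelV v)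
      + ∣ M ∩ₑ isRed ∣ₑ + ∣ M ∩ₑ E[ L ] ∣ₑ
      ≡⟨ cong (λ k → k + ∣ M ∩ₑ isRed ∣ₑ + ∣ M ∩ₑ E[ L ] ∣ₑ)
              (cong₂ _+_ (trans (∑∑-multiplicity-*ˡ M labelU) (∑-weights-1 n degU≡1 labelU))
                         (trans (∑∑-multiplicity-*ʳ M labelV) (∑-weights-1 n degV≡1 labelV))) ⟩
    ones L + ∣ M ∩ₑ isRed ∣ₑ + ∣ M ∩ₑ E[ L ] ∣ₑ ∎

claim3p1 : (n : ℕ) (M : EdgeSet n) (L : Labeling n) →
    IsPerfectMatching M →
    ∣ M ∩ₑ isRed ∣ₑ % 2 ≡ 1 →
    ones L % 2 ≡ n % 2 →
    1 ≤ ∣ M ∩ₑ E[ L ] ∣ₑ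
claim3p1 n M L isPM red-odd ones≡n = parity≡1ℙ⇒1≤n (p+1ℙ+q≡p⇒q≡1ℙ (parity n) _ (begin
  parity n ℙ.+ 1ℙ ℙ.+ parity X
    ≡⟨ cong₂ (λ p q → p ℙ.+ q ℙ.+ parity X) parity-ones parity-red ⟨
  parity (ones L) ℙ.+ parity R ℙ.+ parity X
    ≡⟨ cong (ℙ._+ parity X) (+-homo-+ (ones L) R) ⟨
  parity (ones L + R) ℙ.+ parity X
    ≡⟨ +-homo-+ (ones L + R) X ⟨
  parity (ones L + R + X)
    ≡⟨ perfectMatching-parity M L isPM ⟩
  parity n ∎))
  where
  R X : ℕ
  R = ∣ M ∩ₑ isRed ∣ₑ
  X = ∣ M ∩ₑ E[ L ] ∣ₑ

  parity-ones : parity (ones L) ≡ parity n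
  parity-ones = trans (sym (parity-%2 (ones L))) (trans (cong parity ones≡n) (parity-%2 n))

  parity-red : parity R ≡ 1ℙ
  parity-red = trans (sym (parity-%2 R)) (cong parity red-odd)
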